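{- Let $(D,X)$ be a dessin d'enfant with edge set $\mathcal E$ and monodromy pair $(\sigma_\circ,\sigma_\bullet)$, and let $e\in\mathcal E$. If $D\setminus e$ is disconnected then $e$ and $\sigma_\circ(e)$ lie in the same $\sigma_\circ\sigma_\bullet$-orbit. If $X$ is the sphere, the converse holds.
   Context: Permutations compose functionally. A dessin d'enfant is a finite bicolored graph $D$ (vertices white or black, every vertex incident to an edge, every edge joins a white and a black vertex; multiple edges allowed) embedded in a connected oriented compact surface $X$ without boundary so that $X\setminus D$ is a disjoint union of open discs. Its monodromy pair: $\sigma_\circ$ (resp. $\sigma_\bullet$) sends each edge to the next edge around its white (resp. black) vertex in the cyclic order given by the orientation of $X$. $D\setminus e$ is the graph with the same vertices as $D$ and all edges except $e$. -}

module Defs where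

open import Data.Nat using (ℕ; zero; suc; _+_; _≤ᵇ_)
open import Data.Bool using (Bool; true; false; _∧_)
open import Data.Fin using (Fin; toℕ)
open import Data.Fin.Permutation using (Permutation′; _⟨$⟩ʳ_)
open import Data.List using (List; length; filter; allFin; upTo; foldr)
open import Data.Product using (∃)
open import Relation.Binary.PropositionalEquality using (_≡_; _≢_)
open import Relation.Nullary.Decidable using (T?)
open import Data.Bool using (T)
open import Function using (_∘_)

iter : ∀ {A : Set} → (A → A) → ℕ → A → A
iter f zero    x = x
iter f (suc k) x = f (iter f k x)

-- A dessin d'enfant with n edges (edge set Fin n) is encoded by its
-- monodromy pair (σ∘ , σ•), required to generate a transitive group.
-- Reach σw σb x y : y is obtained from x by applying σ∘ and σ• repeatedly
-- (for permutations of a finite set, this is the orbit of the generated group).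
data Reach {n : ℕ} (σw σb : Permutation′ n) : Fin n → Fin n → Set where
  here  : ∀ {x} → Reach σw σb x x
  stepW : ∀ {x y} → Reach σw σb (σw ⟨$⟩ʳ x) y → Reach σw σb x y
  stepB : ∀ {x y} → Reach σw σb (σb ⟨$⟩ʳ x) y → Reach σw σb x y

Transitive : ∀ {n} → Permutation′ n → Permutation′ n → Set
Transitive σw σb = ∀ x y → Reach σw σb x y

-- Vertices of D: white vertices = σ∘-cycles, black vertices = σ•-cycles.
-- A vertex is represented by a colour and an edge incident to it.
data Colour : Set where
  white black : Colour


-- Path n σw σb e (c , x) (d , y): the vertex of colour c containing edge x
-- and the vertex of colour d containing edge y are joined by a path in D ∖ e.
data Path {n : ℕ} (σw σb : Permutation′ n) (e : Fin n) :
          Colour → Fin n → Colour → Fin n → Set where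
  refl′   : ∀ {c x} → Path σw σb e c x c x
  aroundW : ∀ {x} → Path σw σb e white x white (σw ⟨$⟩ʳ x)
  aroundB : ∀ {x} → Path σw σb e black x black (σb ⟨$⟩ʳ x)
  edge    : ∀ {f} → f ≢ e → Path σw σb e white f black f
  sym′    : ∀ {c x d y} → Path σw σb e c x d y → Path σw σb e d y c x
  trans′  : ∀ {c x d y c′ z} → Path σw σb e c x d y → Path σw σb e d y c′ z
          → Path σw σb e c x c′ z

ConnectedMinus : ∀ {n} → Permutation′ n → Permutation′ n → Fin n → Set
ConnectedMinus σw σb e = ∀ c x d y → Path σw σb e c x d y

SameOrbit : ∀ {n} → (Fin n → Fin n) → Fin n → Fin n → Set
SameOrbit p x y = ∃ λ k → iter p k x ≡ y

isCycleMin : ∀ {n} → (Fin n → Fin n) → Fin n → Bool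
isCycleMin {n} p x = foldr (λ k b → (toℕ x ≤ᵇ toℕ (iter p k x)) ∧ b) true (upTo n)

cycles : ∀ {n} → (Fin n → Fin n) → ℕ
cycles {n} p = length (filter (λ x → T? (isCycleMin p x)) (allFin n))

-- X is the sphere: Euler characteristic V − E + F = 2, where
-- V = #cycles σ∘ + #cycles σ•, E = n, F = #cycles (σ∘σ•).
IsSphere : ∀ {n} → Permutation′ n → Permutation′ n → Set
IsSphere {n} σw σb =
  cycles (σw ⟨$⟩ʳ_) + cycles (σb ⟨$⟩ʳ_)
    + cycles (λ x → σw ⟨$⟩ʳ (σb ⟨$⟩ʳ x)) ≡ n + 2

-- If e and σ∘ e lie on different faces, the boundary of the face through σ• e leads from the
-- black end of e to its white end without using e, so D ∖ e stays connected.
--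
-- Conversely, let X be the sphere, e and σ∘ e share a face, and suppose D ∖ e is connected.
-- If e is alone at its black vertex, that vertex is isolated in D ∖ e. Otherwise detach e from
-- its black vertex, replacing σ• by (e u) σ• where σ• u = e. Multiplying a permutation by a
-- transposition (a b) cuts a cycle in two when a and b share it and joins two cycles otherwise.
-- Here it adds a black vertex and, since e and u share a face, a face, while connectivity
-- survives; the new dessin has V − E + F = 4. This contradicts V − E + F ≤ 2 for connected
-- dessins, proved by joining cycles of σ• (which cuts faces) until every σ∘-step stays inside
-- a σ•-cycle. Then σ• is a single cycle and the bound reduces to d(σ•) ≤ d(σ∘) + d(σ∘σ•) for
-- d(π) = n − #cycles π, the least number of transpositions with product π.

module Submission where

open import Defs
open import Data.Nat using (ℕ)
open import Data.Fin using (Fin)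
open import Data.Fin.Permutation using (Permutation′; _⟨$⟩ʳ_)
open import Data.Product using (_×_)
open import Relation.Nullary using (¬_)

open import Data.Bool using (Bool; true; false; T; _∧_; if_then_else_)
open import Data.Bool.Properties using (T-∧)
open import Data.Empty using (⊥-elim)
open import Data.Fin as Fin using (toℕ)
import Data.Fin.Properties as Fin
open import Data.Fin.Permutation as Perm using (_⟨$⟩ˡ_; inverseˡ; inverseʳ; _∘ₚ_)
import Data.Fin.Permutation.Components as PC
open import Data.List using ([]; _∷_; foldr; upTo; tabulate; length; filter)
open import Data.List.Membership.Propositional.Properties using (∈-upTo⁺)
open import Data.List.Properties using (foldr-cong)
open import Data.List.Relation.Unary.All as All using (All; []; _∷_)
open import Data.Nat as ℕ using (zero; suc; _+_; _∸_; _≤_; _<_; z≤n; s≤s; z<s)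
open import Data.Nat.Induction using (<-wellFounded)
import Data.Nat.Properties as ℕ
open import Data.Product using (∃; _,_)
open import Data.Sum as Sum using (_⊎_; inj₁; inj₂)
open import Data.Unit using (tt)
open import Function using (_∘_; flip; _⇔_; mk⇔; Equivalence)
open import Induction.WellFounded using (Acc; acc)
open import Relation.Binary.PropositionalEquality
open import Relation.Nullary using (Dec; yes; no; does; contradiction)
open import Relation.Nullary.Decidable
  using (map′; _×-dec_; ¬?; T?; dec-true; dec-false; decidable-stable)
open import Relation.Unary using (Decidable)

open Equivalence using (to; from)

iter-+ : ∀ {A : Set} (f : A → A) i j x → iter f (i + j) x ≡ iter f i (iter f j x)
iter-+ f zero    j x = refl
iter-+ f (suc i) j x = cong f (iter-+ f i j x)

iter-suc′ : ∀ {A : Set} (f : A → A) k x → iter f (suc k) x ≡ iter f k (f x)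
iter-suc′ f zero    x = refl
iter-suc′ f (suc k) x = cong f (iter-suc′ f k x)

iter-cong : ∀ {A : Set} {f g : A → A} → (∀ x → f x ≡ g x) → ∀ k x → iter f k x ≡ iter g k x
iter-cong         f≗g zero    x = refl
iter-cong {f = f} f≗g (suc k) x = trans (cong f (iter-cong f≗g k x)) (f≗g _)

iter-∸-fix : ∀ {A : Set} (f : A → A) {m j x} → m ≤ j → iter f m x ≡ x →
             iter f (j ∸ m) x ≡ iter f j x
iter-∸-fix f {m} {j} {x} m≤j fᵐx≡x = begin
  iter f (j ∸ m) x              ≡⟨ cong (iter f (j ∸ m)) (sym fᵐx≡x) ⟩
  iter f (j ∸ m) (iter f m x)   ≡⟨ sym (iter-+ f (j ∸ m) m x) ⟩
  iter f (j ∸ m + m) x          ≡⟨ cong (λ t → iter f t x) (ℕ.m∸n+n≡m m≤j) ⟩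
  iter f j x                    ∎
  where open ≡-Reasoning

least-witness : ∀ {P : ℕ → Set} → Decidable P → ∀ {k} → P k →
                ∃ λ j → P j × (∀ {i} → i < j → ¬ P i)
least-witness {P} P? {k} pk = go k (<-wellFounded k) pk
  where
  go : ∀ k → Acc _<_ k → P k → ∃ λ j → P j × (∀ {i} → i < j → ¬ P i)
  go k (acc smaller) pk with ℕ.anyUpTo? P? k
  ... | yes (i , i<k , pi) = go i (smaller i<k) pi
  ... | no none            = k , pk , λ i<k pi → none (_ , i<k , pi)

T-foldr-∧ : ∀ {A : Set} (g : A → Bool) xs → T (foldr (λ x b → g x ∧ b) true xs) ⇔ All (T ∘ g) xs
T-foldr-∧ g []       = mk⇔ (λ _ → []) (λ _ → tt)
T-foldr-∧ g (x ∷ xs) = mk⇔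
  (λ t → let (gx , rest) = to T-∧ t in gx ∷ to (T-foldr-∧ g xs) rest)
  (λ { (gx ∷ rest) → from T-∧ (gx , from (T-foldr-∧ g xs) rest) })

count : ∀ n → (Fin n → Bool) → ℕ
count zero    b = 0
count (suc n) b = if b Fin.zero then suc (count n (b ∘ Fin.suc)) else count n (b ∘ Fin.suc)

length-filter-tabulate : ∀ {A : Set} n (g : Fin n → A) (b : A → Bool) →
                         length (filter (T? ∘ b) (tabulate g)) ≡ count n (b ∘ g)
length-filter-tabulate zero    g b = refl
length-filter-tabulate (suc n) g b with b (g Fin.zero)
... | true  = cong suc (length-filter-tabulate n (g ∘ Fin.suc) b)
... | false = length-filter-tabulate n (g ∘ Fin.suc) b

count-≤ : ∀ n (b : Fin n → Bool) → count n b ≤ n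
count-≤ zero    b = z≤n
count-≤ (suc n) b with b Fin.zero
... | true  = s≤s (count-≤ n (b ∘ Fin.suc))
... | false = ℕ.m≤n⇒m≤1+n (count-≤ n (b ∘ Fin.suc))

count-cong : ∀ n {b c : Fin n → Bool} → (∀ x → T (b x) ⇔ T (c x)) → count n b ≡ count n c
count-cong zero    b⇔c = refl
count-cong (suc n) {b} {c} b⇔c with b Fin.zero | c Fin.zero | b⇔c Fin.zero
... | true  | true  | _  = cong suc (count-cong n (b⇔c ∘ Fin.suc))
... | false | false | _  = count-cong n (b⇔c ∘ Fin.suc)
... | true  | false | eq = ⊥-elim (to eq tt)
... | false | true  | eq = ⊥-elim (from eq tt)

count-false : ∀ n → count n (λ _ → false) ≡ 0
count-false zero    = refl
count-false (suc n) = count-false n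

count-suc : ∀ n (b c : Fin n → Bool) (x₀ : Fin n) → ¬ T (b x₀) →
            (∀ x → T (c x) ⇔ (T (b x) ⊎ x ≡ x₀)) → count n c ≡ suc (count n b)
count-suc (suc n) b c Fin.zero ¬bx₀ c⇔b+x₀ with b Fin.zero | c Fin.zero | c⇔b+x₀ Fin.zero
... | true  | _     | _  = ⊥-elim (¬bx₀ tt)
... | false | false | eq = ⊥-elim (from eq (inj₂ refl))
... | false | true  | _  = cong suc (count-cong n λ x →
                                mk⇔ (not-x₀ x ∘ to (c⇔b+x₀ (Fin.suc x))) (from (c⇔b+x₀ (Fin.suc x)) ∘ inj₁))
  where
  not-x₀ : ∀ x → T (b (Fin.suc x)) ⊎ Fin.suc x ≡ Fin.zero → T (b (Fin.suc x))
  not-x₀ x (inj₁ t) = t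
count-suc (suc n) b c (Fin.suc y) ¬bx₀ c⇔b+x₀
  with count-suc n (b ∘ Fin.suc) (c ∘ Fin.suc) y ¬bx₀ (λ x →
         mk⇔ (Sum.map₂ Fin.suc-injective ∘ to (c⇔b+x₀ (Fin.suc x)))
             (from (c⇔b+x₀ (Fin.suc x)) ∘ Sum.map₂ (cong Fin.suc)))
... | ih with b Fin.zero | c Fin.zero | c⇔b+x₀ Fin.zero
... | true  | true  | _  = cong suc ih
... | false | false | _  = ih
... | true  | false | eq = ⊥-elim (from eq (inj₁ tt))
... | false | true  | eq with to eq tt
...   | inj₁ ()
...   | inj₂ ()

count-≤1 : ∀ n (b : Fin n → Bool) → (∀ {x y} → T (b x) → T (b y) → x ≡ y) → count n b ≤ 1
count-≤1 n b unique with Fin.any? (T? ∘ b)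
... | yes (x₀ , bx₀) =
  ℕ.≤-reflexive (trans (count-suc n (λ _ → false) b x₀ (λ ()) b⇔x₀) (cong suc (count-false n)))
  where
  b⇔x₀ : ∀ x → T (b x) ⇔ (T false ⊎ x ≡ x₀)
  b⇔x₀ x = mk⇔ (λ bx → inj₂ (unique bx bx₀)) λ { (inj₂ refl) → bx₀ }
... | no none = subst (_≤ 1) (sym (trans (count-cong n b⇔false) (count-false n))) z≤n
  where
  b⇔false : ∀ x → T (b x) ⇔ T false
  b⇔false x = mk⇔ (λ bx → none (x , bx)) λ ()

#cycles : ∀ {n} → Permutation′ n → ℕ
#cycles p = cycles (p ⟨$⟩ʳ_)

cycles≡count : ∀ {n} (f : Fin n → Fin n) → cycles f ≡ count n (isCycleMin f)
cycles≡count {n} f = length-filter-tabulate n (λ x → x) (isCycleMin f)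

cycles-≤ : ∀ {n} (f : Fin n → Fin n) → cycles f ≤ n
cycles-≤ {n} f = subst (_≤ n) (sym (cycles≡count f)) (count-≤ n (isCycleMin f))

cycles-cong : ∀ {n} {f g : Fin n → Fin n} → (∀ x → f x ≡ g x) → cycles f ≡ cycles g
cycles-cong {n} {f} {g} f≗g = begin
  cycles f                 ≡⟨ cycles≡count f ⟩
  count n (isCycleMin f)   ≡⟨ count-cong n (λ x → subst (λ b → _ ⇔ T b) (isCycleMin-cong x) ⇔-refl) ⟩
  count n (isCycleMin g)   ≡⟨ sym (cycles≡count g) ⟩
  cycles g                 ∎
  where
  open ≡-Reasoning
  isCycleMin-cong : ∀ x → isCycleMin f x ≡ isCycleMin g x
  isCycleMin-cong x =
    foldr-cong (λ k b → cong (λ z → (toℕ x ℕ.≤ᵇ toℕ z) ∧ b) (iter-cong f≗g k x)) refl (upTo n)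
  ⇔-refl : ∀ {A : Set} → A ⇔ A
  ⇔-refl = mk⇔ (λ a → a) (λ a → a)

SameCycle : ∀ {n} → Permutation′ n → Fin n → Fin n → Set
SameCycle p = SameOrbit (p ⟨$⟩ʳ_)

module _ {n : ℕ} (p : Permutation′ n) where

  private
    π : Fin n → Fin n
    π = p ⟨$⟩ʳ_

  ⟨$⟩ʳ-injective : ∀ {x y} → π x ≡ π y → x ≡ y
  ⟨$⟩ʳ-injective {x} {y} eq = trans (sym (inverseˡ p)) (trans (cong (p ⟨$⟩ˡ_) eq) (inverseˡ p))

  ⟨$⟩ˡ-injective : ∀ {x y} → p ⟨$⟩ˡ x ≡ p ⟨$⟩ˡ y → x ≡ y
  ⟨$⟩ˡ-injective {x} {y} eq = trans (sym (inverseʳ p)) (trans (cong π eq) (inverseʳ p))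

  iter-injective : ∀ k {x y} → iter π k x ≡ iter π k y → x ≡ y
  iter-injective zero    eq = eq
  iter-injective (suc k) eq = iter-injective k (⟨$⟩ʳ-injective eq)

  period : ∀ x → ∃ λ m → 0 < m × m ≤ n × iter π m x ≡ x
  period x with Fin.pigeonhole (ℕ.n<1+n n) (λ (i : Fin (suc n)) → iter π (toℕ i) x)
  ... | i , j , i<j , πⁱx≡πʲx =
    d , ℕ.m<n⇒0<n∸m i<j , d≤n , sym (iter-injective (toℕ i) πⁱx≡πⁱ⁺ᵈx)
    where
    d = toℕ j ∸ toℕ i
    d≤n : d ≤ n
    d≤n = ℕ.≤-trans (ℕ.m∸n≤m (toℕ j) (toℕ i)) (ℕ.≤-pred (Fin.toℕ<n j))
    πⁱx≡πⁱ⁺ᵈx : iter π (toℕ i) x ≡ iter π (toℕ i) (iter π d x)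
    πⁱx≡πⁱ⁺ᵈx = begin
      iter π (toℕ i) x            ≡⟨ πⁱx≡πʲx ⟩
      iter π (toℕ j) x            ≡⟨ cong (λ t → iter π t x) (sym (ℕ.m+[n∸m]≡n (ℕ.<⇒≤ i<j))) ⟩
      iter π (toℕ i + d) x        ≡⟨ iter-+ π (toℕ i) d x ⟩
      iter π (toℕ i) (iter π d x) ∎
      where open ≡-Reasoning

  sameCycle-refl : ∀ {x} → SameCycle p x x
  sameCycle-refl = 0 , refl

  sameCycle-step : ∀ x → SameCycle p x (π x)
  sameCycle-step x = 1 , refl

  sameCycle-trans : ∀ {x y z} → SameCycle p x y → SameCycle p y z → SameCycle p x z
  sameCycle-trans {x} (k , refl) (l , refl) = l + k , iter-+ π l k x

  sameCycle-step⁻¹ : ∀ x → SameCycle p (π x) x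
  sameCycle-step⁻¹ x with period x
  ... | suc m , _ , _ , πᵐ⁺¹x≡x = m , trans (sym (iter-suc′ π m x)) πᵐ⁺¹x≡x

  sameCycle-sym : ∀ {x y} → SameCycle p x y → SameCycle p y x
  sameCycle-sym (zero  , refl) = sameCycle-refl
  sameCycle-sym {x} (suc k , refl) =
    sameCycle-trans (sameCycle-step⁻¹ (iter π k x)) (sameCycle-sym (k , refl))

  sameCycle-bounded : ∀ {x y} → SameCycle p x y → ∃ λ (i : Fin n) → iter π (toℕ i) x ≡ y
  sameCycle-bounded {x} {y} (k , πᵏx≡y)
    with least-witness (λ k → iter π k x Fin.≟ y) {k} πᵏx≡y | period x
  ... | j , πʲx≡y , minimal | m , 0<m , m≤n , πᵐx≡x =
    Fin.fromℕ< j<n , trans (cong (λ t → iter π t x) (Fin.toℕ-fromℕ< j<n)) πʲx≡y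
    where
    j<m : j < m
    j<m = ℕ.≰⇒> λ m≤j → minimal (ℕ.∸-monoʳ-< 0<m m≤j) (trans (iter-∸-fix π m≤j πᵐx≡x) πʲx≡y)
    j<n : j < n
    j<n = ℕ.<-≤-trans j<m m≤n

  sameCycle? : ∀ x y → Dec (SameCycle p x y)
  sameCycle? x y = map′ (λ (i , πⁱx≡y) → toℕ i , πⁱx≡y) sameCycle-bounded
                        (Fin.any? (λ (i : Fin n) → iter π (toℕ i) x Fin.≟ y))

  CycleMinimum : Fin n → Set
  CycleMinimum x = ∀ {y} → SameCycle p x y → toℕ x ≤ toℕ y

  cycleMinimum-unique : ∀ {x y} → SameCycle p x y → CycleMinimum x → CycleMinimum y → x ≡ y
  cycleMinimum-unique x∼y min-x min-y =
    Fin.toℕ-injective (ℕ.≤-antisym (min-x x∼y) (min-y (sameCycle-sym x∼y)))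

  cycleMinimum-exists : ∀ x → ∃ λ m → SameCycle p x m × CycleMinimum m
  cycleMinimum-exists x with least-witness value? {toℕ x} (x , sameCycle-refl , refl)
    where
    value? : Decidable (λ j → ∃ λ y → SameCycle p x y × toℕ y ≡ j)
    value? j = Fin.any? (λ y → sameCycle? x y ×-dec (toℕ y ℕ.≟ j))
  ... | _ , (m , x∼m , refl) , minimal =
    m , x∼m , λ m∼y → ℕ.≮⇒≥ λ y<m → minimal y<m (_ , sameCycle-trans x∼m m∼y , refl)

  isCycleMin⇒cycleMinimum : ∀ x → T (isCycleMin π x) → CycleMinimum x
  isCycleMin⇒cycleMinimum x t x∼y with sameCycle-bounded x∼y
  ... | i , refl =
    ℕ.≤ᵇ⇒≤ (toℕ x) _ (All.lookup (to (T-foldr-∧ _ (upTo n)) t) (∈-upTo⁺ (Fin.toℕ<n i)))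

  cycleMinimum⇒isCycleMin : ∀ x → CycleMinimum x → T (isCycleMin π x)
  cycleMinimum⇒isCycleMin x min-x =
    from (T-foldr-∧ _ (upTo n)) (All.tabulate λ {k} _ → ℕ.≤⇒≤ᵇ (min-x (k , refl)))

  cycleMinimum? : ∀ x → Dec (CycleMinimum x)
  cycleMinimum? x = map′ (isCycleMin⇒cycleMinimum x) (cycleMinimum⇒isCycleMin x) (T? (isCycleMin π x))

cycles-suc : ∀ {n} (p q : Permutation′ n) (x₀ : Fin n) → ¬ CycleMinimum p x₀ →
             (∀ x → CycleMinimum q x ⇔ (CycleMinimum p x ⊎ x ≡ x₀)) → #cycles q ≡ suc (#cycles p)
cycles-suc {n} p q x₀ x₀-not-p minima = begin
  #cycles q                            ≡⟨ cycles≡count (q ⟨$⟩ʳ_) ⟩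
  count n (isCycleMin (q ⟨$⟩ʳ_))       ≡⟨ count-suc n _ _ x₀ x₀-not-p′ T-minima ⟩
  suc (count n (isCycleMin (p ⟨$⟩ʳ_))) ≡⟨ cong suc (sym (cycles≡count (p ⟨$⟩ʳ_))) ⟩
  suc (#cycles p)                      ∎
  where
  open ≡-Reasoning
  x₀-not-p′ : ¬ T (isCycleMin (p ⟨$⟩ʳ_) x₀)
  x₀-not-p′ = x₀-not-p ∘ isCycleMin⇒cycleMinimum p x₀
  T-minima : ∀ x → T (isCycleMin (q ⟨$⟩ʳ_) x) ⇔ (T (isCycleMin (p ⟨$⟩ʳ_) x) ⊎ x ≡ x₀)
  T-minima x = mk⇔
    (Sum.map₁ (cycleMinimum⇒isCycleMin p x) ∘ to (minima x) ∘ isCycleMin⇒cycleMinimum q x)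
    (cycleMinimum⇒isCycleMin q x ∘ from (minima x) ∘ Sum.map₁ (isCycleMin⇒cycleMinimum p x))

sameOrbit-least : ∀ {n} {f : Fin n → Fin n} {R : Fin n → Fin n → Set} →
                  (∀ {x} → R x x) → (∀ {x y z} → R x y → R y z → R x z) → (∀ x → R x (f x)) →
                  ∀ {x y} → SameOrbit f x y → R x y
sameOrbit-least {f = f} {R} R-refl R-trans step {x} (k , refl) = go k
  where
  go : ∀ k → R x (iter f k x)
  go zero    = R-refl
  go (suc k) = R-trans (go k) (step _)

module _ {n : ℕ} (a b : Fin n) where

  private
    τ : Fin n → Fin n
    τ = PC.transpose a b

  transpose-a : τ a ≡ b
  transpose-a rewrite dec-true (a Fin.≟ a) refl = refl

  transpose-b : τ b ≡ a
  transpose-b with b Fin.≟ a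
  ... | yes b≡a = b≡a
  ... | no  _   rewrite dec-true (b Fin.≟ b) refl = refl

  transpose-other : ∀ {x} → x ≢ a → x ≢ b → τ x ≡ x
  transpose-other {x} x≢a x≢b rewrite dec-false (x Fin.≟ a) x≢a | dec-false (x Fin.≟ b) x≢b = refl

  transpose-involutive : ∀ x → τ (τ x) ≡ x
  transpose-involutive x = cases (x Fin.≟ a) (x Fin.≟ b)
    where
    cases : Dec (x ≡ a) → Dec (x ≡ b) → τ (τ x) ≡ x
    cases (yes refl) _          = trans (cong τ transpose-a) transpose-b
    cases (no _)     (yes refl) = trans (cong τ transpose-b) transpose-a
    cases (no x≢a)   (no x≢b)   = trans (cong τ (transpose-other x≢a x≢b)) (transpose-other x≢a x≢b)

transpose-conjugate : ∀ {n} (p : Permutation′ n) (a b x : Fin n) →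
  p ⟨$⟩ʳ PC.transpose (p ⟨$⟩ˡ a) (p ⟨$⟩ˡ b) x ≡ PC.transpose a b (p ⟨$⟩ʳ x)
transpose-conjugate p a b x = cases (x Fin.≟ a′) (x Fin.≟ b′)
  where
  a′ = p ⟨$⟩ˡ a
  b′ = p ⟨$⟩ˡ b
  ≢-transport : ∀ {c} → x ≢ p ⟨$⟩ˡ c → p ⟨$⟩ʳ x ≢ c
  ≢-transport x≢c px≡c = x≢c (trans (sym (inverseˡ p)) (cong (p ⟨$⟩ˡ_) px≡c))
  cases : Dec (x ≡ a′) → Dec (x ≡ b′) → p ⟨$⟩ʳ PC.transpose a′ b′ x ≡ PC.transpose a b (p ⟨$⟩ʳ x)
  cases (yes refl) _          = begin
    p ⟨$⟩ʳ PC.transpose a′ b′ a′ ≡⟨ cong (p ⟨$⟩ʳ_) (transpose-a a′ b′) ⟩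
    p ⟨$⟩ʳ b′                    ≡⟨ inverseʳ p ⟩
    b                            ≡⟨ sym (transpose-a a b) ⟩
    PC.transpose a b a           ≡⟨ cong (PC.transpose a b) (sym (inverseʳ p)) ⟩
    PC.transpose a b (p ⟨$⟩ʳ a′) ∎
    where open ≡-Reasoning
  cases (no _)     (yes refl) = begin
    p ⟨$⟩ʳ PC.transpose a′ b′ b′ ≡⟨ cong (p ⟨$⟩ʳ_) (transpose-b a′ b′) ⟩
    p ⟨$⟩ʳ a′                    ≡⟨ inverseʳ p ⟩
    a                            ≡⟨ sym (transpose-b a b) ⟩
    PC.transpose a b b           ≡⟨ cong (PC.transpose a b) (sym (inverseʳ p)) ⟩
    PC.transpose a b (p ⟨$⟩ʳ b′) ∎
    where open ≡-Reasoning
  cases (no x≢a′)  (no x≢b′)  = trans (cong (p ⟨$⟩ʳ_) (transpose-other a′ b′ x≢a′ x≢b′))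
    (sym (transpose-other a b (≢-transport x≢a′) (≢-transport x≢b′)))

module Transposed {n : ℕ} (p q : Permutation′ n) (a b : Fin n) (a≢b : a ≢ b)
                  (q≗p∘τ : ∀ x → q ⟨$⟩ʳ x ≡ p ⟨$⟩ʳ PC.transpose a b x) where

  private
    π ρ : Fin n → Fin n
    π = p ⟨$⟩ʳ_
    ρ = q ⟨$⟩ʳ_

  ρa≡πb : ρ a ≡ π b
  ρa≡πb = trans (q≗p∘τ a) (cong π (transpose-a a b))

  ρb≡πa : ρ b ≡ π a
  ρb≡πa = trans (q≗p∘τ b) (cong π (transpose-b a b))

  ρ≡π-other : ∀ {x} → x ≢ a → x ≢ b → ρ x ≡ π x
  ρ≡π-other x≢a x≢b = trans (q≗p∘τ _) (cong π (transpose-other a b x≢a x≢b))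

  cut-refines : SameCycle p a b → ∀ {x y} → SameCycle q x y → SameCycle p x y
  cut-refines a∼b = sameOrbit-least (sameCycle-refl p) (sameCycle-trans p) ρ-step
    where
    b∼a : SameCycle p b a
    b∼a = sameCycle-sym p a∼b
    ρ-step : ∀ z → SameCycle p z (ρ z)
    ρ-step z with z Fin.≟ a | z Fin.≟ b
    ... | yes refl | _        = subst (SameCycle p a) (sym ρa≡πb) (sameCycle-trans p a∼b (sameCycle-step p b))
    ... | no _     | yes refl = subst (SameCycle p b) (sym ρb≡πa) (sameCycle-trans p b∼a (sameCycle-step p a))
    ... | no z≢a   | no z≢b   = subst (SameCycle p z) (sym (ρ≡π-other z≢a z≢b)) (sameCycle-step p z)

  cut-preserves-other : SameCycle p a b → ∀ {x y} → ¬ SameCycle p x a →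
                        SameCycle p x y → SameCycle q x y
  cut-preserves-other a∼b {x} x≁a (k , refl) = k , ρᵏ≡πᵏ k
    where
    ρᵏ≡πᵏ : ∀ k → iter ρ k x ≡ iter π k x
    ρᵏ≡πᵏ zero    = refl
    ρᵏ≡πᵏ (suc k) = trans (cong ρ (ρᵏ≡πᵏ k))
      (ρ≡π-other (λ πᵏx≡a → x≁a (k , πᵏx≡a))
                 (λ πᵏx≡b → x≁a (sameCycle-trans p (k , πᵏx≡b) (sameCycle-sym p a∼b))))

  cut-covers : ∀ {x} → SameCycle p a x → SameCycle q a x ⊎ SameCycle q b x
  cut-covers (k , refl) = go k
    where
    go : ∀ k → SameCycle q a (iter π k a) ⊎ SameCycle q b (iter π k a)
    go zero = inj₁ (sameCycle-refl q)
    go (suc k) with iter π k a Fin.≟ a | iter π k a Fin.≟ b | go k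
    ... | yes πᵏa≡a | _         | _        = inj₂ (1 , trans ρb≡πa (cong π (sym πᵏa≡a)))
    ... | no _      | yes πᵏa≡b | _        = inj₁ (1 , trans ρa≡πb (cong π (sym πᵏa≡b)))
    ... | no πᵏa≢a  | no πᵏa≢b  | a∼y⊎b∼y  = Sum.map (extend πᵏa≢a πᵏa≢b) (extend πᵏa≢a πᵏa≢b) a∼y⊎b∼y
      where
      extend : ∀ {c y} → y ≢ a → y ≢ b → SameCycle q c y → SameCycle q c (π y)
      extend y≢a y≢b c∼y = sameCycle-trans q c∼y (1 , ρ≡π-other y≢a y≢b)

  -- The ρ-orbit of a is the π-arc π b, π² b, …, πᵏ⁺¹ b = a, which avoids b.
  cut-separates : SameCycle p a b → ¬ SameCycle q a b
  cut-separates a∼b with sameCycle-sym p a∼b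
  ... | l , πˡb≡a with least-witness (λ k → iter π k b Fin.≟ a) {l} πˡb≡a
  ... | zero  , b≡a , _ = ⊥-elim (a≢b (sym b≡a))
  ... | suc k , πᵏ⁺¹b≡a , minimal = λ (j , ρʲa≡b) → b∉Arc (ρ-orbit-in-Arc j) ρʲa≡b
    where
    Arc : Fin n → Set
    Arc y = ∃ λ i → i ≤ k × iter π (suc i) b ≡ y

    b∉Arc : ∀ {y} → Arc y → y ≢ b
    b∉Arc (i , i≤k , refl) πⁱ⁺¹b≡b =
      minimal (ℕ.∸-monoʳ-< z<s (s≤s i≤k)) (trans (iter-∸-fix π (s≤s i≤k) πⁱ⁺¹b≡b) πᵏ⁺¹b≡a)

    ρ-closed : ∀ {y} → Arc y → Arc (ρ y)
    ρ-closed (i , i≤k , refl) with ℕ.m≤n⇒m<n∨m≡n i≤k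
    ... | inj₂ refl = 0 , z≤n , sym (trans (cong ρ πᵏ⁺¹b≡a) ρa≡πb)
    ... | inj₁ i<k  = suc i , i<k , sym (ρ≡π-other (minimal (s≤s i<k)) (b∉Arc (i , i≤k , refl)))

    ρ-orbit-in-Arc : ∀ j → Arc (iter ρ j a)
    ρ-orbit-in-Arc zero    = k , ℕ.≤-refl , πᵏ⁺¹b≡a
    ρ-orbit-in-Arc (suc j) = ρ-closed (ρ-orbit-in-Arc j)

  -- ρ follows π b, π² b, … around the whole π-cycle of b, which avoids a.
  join-connects : ¬ SameCycle p a b → SameCycle q a b
  join-connects a≁b with period p b
  ... | suc m , _ , _ , πᵐ⁺¹b≡b
    with least-witness (λ k → iter π (suc k) b Fin.≟ b) {m} πᵐ⁺¹b≡b
  ... | k , πᵏ⁺¹b≡b , minimal = suc k , trans (ρⁱ⁺¹a≡πⁱ⁺¹b k ℕ.≤-refl) πᵏ⁺¹b≡b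
    where
    ρⁱ⁺¹a≡πⁱ⁺¹b : ∀ i → i ≤ k → iter ρ (suc i) a ≡ iter π (suc i) b
    ρⁱ⁺¹a≡πⁱ⁺¹b zero    _   = ρa≡πb
    ρⁱ⁺¹a≡πⁱ⁺¹b (suc i) i<k = trans (cong ρ (ρⁱ⁺¹a≡πⁱ⁺¹b i (ℕ.<⇒≤ i<k)))
      (ρ≡π-other (λ πⁱ⁺¹b≡a → a≁b (sameCycle-sym p (suc i , πⁱ⁺¹b≡a))) (minimal i<k))

  -- The new cycle minimum x₀ is that of the half of the cut cycle not containing the old minimum m.
  private
    cycles-cut-with : SameCycle p a b → ∀ {m} → SameCycle p a m → CycleMinimum p m →
                      ∀ s r → SameCycle q s m → SameCycle p a r → ¬ SameCycle q s r →
                      (∀ {y} → SameCycle p a y → SameCycle q s y ⊎ SameCycle q r y) →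
                      #cycles q ≡ suc (#cycles p)
    cycles-cut-with a∼b {m} a∼m min-m s r s∼m a∼r s≁r covers with cycleMinimum-exists q r
    ... | x₀ , r∼x₀ , min-x₀ = cycles-suc p q x₀ x₀-not-old minima
      where
      x₀-not-old : ¬ CycleMinimum p x₀
      x₀-not-old min-p-x₀ = s≁r (sameCycle-trans q (subst (SameCycle q s) m≡x₀ s∼m) (sameCycle-sym q r∼x₀))
        where
        m∼x₀ : SameCycle p m x₀
        m∼x₀ = sameCycle-trans p (sameCycle-sym p a∼m) (sameCycle-trans p a∼r (cut-refines a∼b r∼x₀))
        m≡x₀ : m ≡ x₀
        m≡x₀ = cycleMinimum-unique p m∼x₀ min-m min-p-x₀

      only-new : ∀ {x} → CycleMinimum q x → ¬ CycleMinimum p x → x ≡ x₀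
      only-new {x} min-q-x not-min-p-x with sameCycle? p x a
      ... | no x≁a = ⊥-elim (not-min-p-x λ x∼y → min-q-x (cut-preserves-other a∼b x≁a x∼y))
      ... | yes x∼a with covers (sameCycle-sym p x∼a)
      ...   | inj₂ r∼x =
        cycleMinimum-unique q (sameCycle-trans q (sameCycle-sym q r∼x) r∼x₀) min-q-x min-x₀
      ...   | inj₁ s∼x = ⊥-elim (not-min-p-x (subst (CycleMinimum p) (sym x≡m) min-m))
        where
        x≡m : x ≡ m
        x≡m = Fin.toℕ-injective (ℕ.≤-antisym
          (min-q-x (sameCycle-trans q (sameCycle-sym q s∼x) s∼m))
          (min-m (sameCycle-trans p (sameCycle-sym p a∼m) (sameCycle-sym p x∼a))))

      minima : ∀ x → CycleMinimum q x ⇔ (CycleMinimum p x ⊎ x ≡ x₀)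
      minima x = mk⇔ classify λ { (inj₁ min-p-x) → min-p-x ∘ cut-refines a∼b ; (inj₂ refl) → min-x₀ }
        where
        classify : CycleMinimum q x → CycleMinimum p x ⊎ x ≡ x₀
        classify min-q-x with cycleMinimum? p x
        ... | yes min-p-x     = inj₁ min-p-x
        ... | no  not-min-p-x = inj₂ (only-new min-q-x not-min-p-x)

  cycles-cut : SameCycle p a b → #cycles q ≡ suc (#cycles p)
  cycles-cut a∼b with cycleMinimum-exists p a
  ... | m , a∼m , min-m with cut-covers a∼m
  ... | inj₁ a∼qm = cycles-cut-with a∼b a∼m min-m a b a∼qm a∼b (cut-separates a∼b) cut-covers
  ... | inj₂ b∼qm = cycles-cut-with a∼b a∼m min-m b a b∼qm (sameCycle-refl p)
                      (cut-separates a∼b ∘ sameCycle-sym q) (Sum.swap ∘ cut-covers)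

module _ {n : ℕ} {p q : Permutation′ n} {a b : Fin n} (a≢b : a ≢ b)
         (q≗p∘τ : ∀ x → q ⟨$⟩ʳ x ≡ p ⟨$⟩ʳ PC.transpose a b x) where

  private
    p≗q∘τ : ∀ x → p ⟨$⟩ʳ x ≡ q ⟨$⟩ʳ PC.transpose a b x
    p≗q∘τ x = sym (trans (q≗p∘τ _) (cong (p ⟨$⟩ʳ_) (transpose-involutive a b x)))

    a∼b-after-join : ¬ SameCycle p a b → SameCycle q a b
    a∼b-after-join = Transposed.join-connects p q a b a≢b q≗p∘τ

  cycles-join : ¬ SameCycle p a b → #cycles p ≡ suc (#cycles q)
  cycles-join a≁b = Transposed.cycles-cut q p a b a≢b p≗q∘τ (a∼b-after-join a≁b)

  join-coarsens : ¬ SameCycle p a b → ∀ {x y} → SameCycle p x y → SameCycle q x y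
  join-coarsens a≁b = Transposed.cut-refines q p a b a≢b p≗q∘τ (a∼b-after-join a≁b)

  cycles-≤-suc : #cycles p ≤ suc (#cycles q)
  cycles-≤-suc with sameCycle? p a b
  ... | yes a∼b = ℕ.m≤n⇒m≤1+n (ℕ.≤-trans (ℕ.n≤1+n _) (ℕ.≤-reflexive (sym cut)))
    where
    cut : #cycles q ≡ suc (#cycles p)
    cut = Transposed.cycles-cut p q a b a≢b q≗p∘τ a∼b
  ... | no  a≁b = ℕ.≤-reflexive (cycles-join a≁b)

cycles-≤1 : ∀ {n} (p : Permutation′ n) → (∀ x y → SameCycle p x y) → #cycles p ≤ 1
cycles-≤1 {n} p connected = subst (_≤ 1) (sym (cycles≡count (p ⟨$⟩ʳ_)))
  (count-≤1 n _ λ {x} {y} tx ty → cycleMinimum-unique p (connected x y)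
                                    (isCycleMin⇒cycleMinimum p x tx) (isCycleMin⇒cycleMinimum p y ty))

-- Induction on n ∸ #cycles α, the number of transpositions needed to write α.
cycles-∘ₚ-≤ : ∀ {n} (α β : Permutation′ n) → #cycles (β ∘ₚ α) + #cycles α ≤ #cycles β + n
cycles-∘ₚ-≤ {n} α β = go _ α (ℕ.m+[n∸m]≡n (cycles-≤ (α ⟨$⟩ʳ_)))
  where
  go : ∀ k α → #cycles α + k ≡ n → #cycles (β ∘ₚ α) + #cycles α ≤ #cycles β + n
  go k α cα+k≡n with Fin.any? (λ a → ¬? (α ⟨$⟩ʳ a Fin.≟ a))
  ... | no none = ℕ.+-mono-≤ (ℕ.≤-reflexive (cycles-cong βα≗β)) (cycles-≤ (α ⟨$⟩ʳ_))
    where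
    βα≗β : ∀ x → (β ∘ₚ α) ⟨$⟩ʳ x ≡ β ⟨$⟩ʳ x
    βα≗β x = decidable-stable (α ⟨$⟩ʳ _ Fin.≟ _) (λ αy≢y → none (_ , αy≢y))
  ... | yes (a , αa≢a) = step k cα+k≡n
    where
    b = α ⟨$⟩ʳ a
    a≢b : a ≢ b
    a≢b = αa≢a ∘ sym
    α′ = Perm.transpose a b ∘ₚ α

    cα′≡1+cα : #cycles α′ ≡ suc (#cycles α)
    cα′≡1+cα = Transposed.cycles-cut α α′ a b a≢b (λ _ → refl) (sameCycle-step α a)

    cβα≤1+cβα′ : #cycles (β ∘ₚ α) ≤ suc (#cycles (β ∘ₚ α′))
    cβα≤1+cβα′ = cycles-≤-suc {p = β ∘ₚ α} {q = β ∘ₚ α′} (a≢b ∘ ⟨$⟩ˡ-injective β)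
                   (λ x → cong (α ⟨$⟩ʳ_) (sym (transpose-conjugate β a b x)))

    step : ∀ k → #cycles α + k ≡ n → #cycles (β ∘ₚ α) + #cycles α ≤ #cycles β + n
    step zero cα+0≡n = ⊥-elim (ℕ.1+n≰n (subst (_≤ n) cα′≡1+n (cycles-≤ (α′ ⟨$⟩ʳ_))))
      where
      cα′≡1+n : #cycles α′ ≡ suc n
      cα′≡1+n = trans cα′≡1+cα (cong suc (trans (sym (ℕ.+-identityʳ _)) cα+0≡n))
    step (suc k) cα+1+k≡n = begin
      #cycles (β ∘ₚ α) + #cycles α        ≤⟨ ℕ.+-monoˡ-≤ (#cycles α) cβα≤1+cβα′ ⟩
      suc (#cycles (β ∘ₚ α′)) + #cycles α ≡⟨ sym (ℕ.+-suc (#cycles (β ∘ₚ α′)) (#cycles α)) ⟩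
      #cycles (β ∘ₚ α′) + suc (#cycles α) ≡⟨ cong (#cycles (β ∘ₚ α′) +_) (sym cα′≡1+cα) ⟩
      #cycles (β ∘ₚ α′) + #cycles α′      ≤⟨ go k α′ cα′+k≡n ⟩
      #cycles β + n                       ∎
      where
      open ℕ.≤-Reasoning
      cα′+k≡n : #cycles α′ + k ≡ n
      cα′+k≡n = trans (cong (_+ k) cα′≡1+cα) (trans (sym (ℕ.+-suc (#cycles α) k)) cα+1+k≡n)

module _ {n : ℕ} {σw σb : Permutation′ n} where

  reach-trans : ∀ {x y z} → Reach σw σb x y → Reach σw σb y z → Reach σw σb x z
  reach-trans here      r′ = r′
  reach-trans (stepW r) r′ = stepW (reach-trans r r′)
  reach-trans (stepB r) r′ = stepB (reach-trans r r′)

  sameCycle⇒reachW : ∀ {x y} → SameCycle σw x y → Reach σw σb x y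
  sameCycle⇒reachW = sameOrbit-least here reach-trans (λ _ → stepW here)

  sameCycle⇒reachB : ∀ {x y} → SameCycle σb x y → Reach σw σb x y
  sameCycle⇒reachB = sameOrbit-least here reach-trans (λ _ → stepB here)

  reach-sym : ∀ {x y} → Reach σw σb x y → Reach σw σb y x
  reach-sym here          = here
  reach-sym {x} (stepW r) = reach-trans (reach-sym r) (sameCycle⇒reachW (sameCycle-step⁻¹ σw x))
  reach-sym {x} (stepB r) = reach-trans (reach-sym r) (sameCycle⇒reachB (sameCycle-step⁻¹ σb x))

euler-arithmetic : ∀ n A B C → C + A ≤ B + n → B ≤ 1 → A + B + C ≤ n + 2
euler-arithmetic n A B C C+A≤B+n B≤1 = begin
  A + B + C       ≡⟨ trans (ℕ.+-comm (A + B) C) (sym (ℕ.+-assoc C A B)) ⟩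
  C + A + B       ≤⟨ ℕ.+-monoˡ-≤ B C+A≤B+n ⟩
  B + n + B       ≡⟨ trans (cong (_+ B) (ℕ.+-comm B n)) (ℕ.+-assoc n B B) ⟩
  n + (B + B)     ≤⟨ ℕ.+-monoʳ-≤ n (ℕ.+-mono-≤ B≤1 B≤1) ⟩
  n + 2           ∎
  where open ℕ.≤-Reasoning

-- Induction on #cycles β: while some x and α (β x) lie in different cycles of β, joining these
-- two cycles cuts a cycle of β ∘ₚ α; once there are none, β has a single cycle.
euler-≤ : ∀ {n} (α β : Permutation′ n) → Transitive α β →
          #cycles α + #cycles β + #cycles (β ∘ₚ α) ≤ n + 2
euler-≤ {n} α β transitive = go _ β refl transitive
  where
  go : ∀ k β → #cycles β ≡ k → Transitive α β → #cycles α + #cycles β + #cycles (β ∘ₚ α) ≤ n + 2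
  go k β cβ≡k transitive with Fin.any? (λ x → ¬? (sameCycle? β x ((β ∘ₚ α) ⟨$⟩ʳ x)))
  ... | no none = euler-arithmetic n (#cycles α) (#cycles β) (#cycles (β ∘ₚ α))
                    (cycles-∘ₚ-≤ α β) (cycles-≤1 β λ x y → reach⇒sameCycle (transitive x y))
    where
    βα-within : ∀ x → SameCycle β x (α ⟨$⟩ʳ (β ⟨$⟩ʳ x))
    βα-within x = decidable-stable (sameCycle? β _ _) (λ x≁βαx → none (x , x≁βαx))

    α-within : ∀ x → SameCycle β x (α ⟨$⟩ʳ x)
    α-within x = sameCycle-trans β
      (subst (λ z → SameCycle β z (β ⟨$⟩ˡ x)) (inverseʳ β) (sameCycle-step⁻¹ β (β ⟨$⟩ˡ x)))
      (subst (SameCycle β (β ⟨$⟩ˡ x)) (cong (α ⟨$⟩ʳ_) (inverseʳ β)) (βα-within (β ⟨$⟩ˡ x)))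

    reach⇒sameCycle : ∀ {x y} → Reach α β x y → SameCycle β x y
    reach⇒sameCycle here      = sameCycle-refl β
    reach⇒sameCycle (stepW r) = sameCycle-trans β (α-within _) (reach⇒sameCycle r)
    reach⇒sameCycle (stepB r) = sameCycle-trans β (sameCycle-step β _) (reach⇒sameCycle r)
  ... | yes (a , a≁b) = step k cβ≡k
    where
    b = (β ∘ₚ α) ⟨$⟩ʳ a
    a≢b : a ≢ b
    a≢b a≡b = a≁b (subst (SameCycle β a) a≡b (sameCycle-refl β))
    β′ = Perm.transpose a b ∘ₚ β

    cβ≡1+cβ′ : #cycles β ≡ suc (#cycles β′)
    cβ≡1+cβ′ = cycles-join {p = β} {q = β′} a≢b (λ _ → refl) a≁b

    cβ′α≡1+cβα : #cycles (β′ ∘ₚ α) ≡ suc (#cycles (β ∘ₚ α))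
    cβ′α≡1+cβα =
      Transposed.cycles-cut (β ∘ₚ α) (β′ ∘ₚ α) a b a≢b (λ _ → refl) (sameCycle-step (β ∘ₚ α) a)

    transitive′ : Transitive α β′
    transitive′ x y = coarsen (transitive x y)
      where
      coarsen : ∀ {x y} → Reach α β x y → Reach α β′ x y
      coarsen here      = here
      coarsen (stepW r) = stepW (coarsen r)
      coarsen (stepB r) = reach-trans (sameCycle⇒reachB β-step′) (coarsen r)
        where β-step′ = join-coarsens {p = β} {q = β′} a≢b (λ _ → refl) a≁b (sameCycle-step β _)

    step : ∀ k → #cycles β ≡ k → #cycles α + #cycles β + #cycles (β ∘ₚ α) ≤ n + 2
    step zero    cβ≡0   = ⊥-elim (ℕ.0≢1+n (trans (sym cβ≡0) cβ≡1+cβ′))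
    step (suc k) cβ≡1+k = begin
      A + #cycles β + C   ≡⟨ cong (λ B → A + B + C) cβ≡1+cβ′ ⟩
      A + suc B′ + C      ≡⟨ cong (_+ C) (ℕ.+-suc A B′) ⟩
      suc (A + B′ + C)    ≡⟨ sym (ℕ.+-suc (A + B′) C) ⟩
      A + B′ + suc C      ≡⟨ cong (A + B′ +_) (sym cβ′α≡1+cβα) ⟩
      A + B′ + C′         ≤⟨ go k β′ (ℕ.suc-injective (trans (sym cβ≡1+cβ′) cβ≡1+k)) transitive′ ⟩
      n + 2               ∎
      where
      open ℕ.≤-Reasoning
      A = #cycles α
      B′ = #cycles β′
      C = #cycles (β ∘ₚ α)
      C′ = #cycles (β′ ∘ₚ α)
-- The edge e is detached from its black vertex, becoming a fixed point of the black permutation.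
detach : ∀ {n} → Permutation′ n → Fin n → Permutation′ n
detach σb e = Perm.transpose e (σb ⟨$⟩ˡ e) ∘ₚ σb

module _ {n : ℕ} {σw σb : Permutation′ n} {e : Fin n} where

  private
    -- The face permutation σ∘ σ•: the composition _∘ₚ_ is diagrammatic.
    φ : Permutation′ n
    φ = σb ∘ₚ σw

  path-invariant : ∀ {A : Set} (g : Colour → Fin n → A) →
                   (∀ x → g white x ≡ g white (σw ⟨$⟩ʳ x)) →
                   (∀ x → g black x ≡ g black (σb ⟨$⟩ʳ x)) →
                   (∀ f → f ≢ e → g white f ≡ g black f) →
                   ∀ {c x d y} → Path σw σb e c x d y → g c x ≡ g d y
  path-invariant g gw gb ge refl′        = refl
  path-invariant g gw gb ge aroundW      = gw _
  path-invariant g gw gb ge aroundB      = gb _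
  path-invariant g gw gb ge (edge f≢e)   = ge _ f≢e
  path-invariant g gw gb ge (sym′ p)     = sym (path-invariant g gw gb ge p)
  path-invariant g gw gb ge (trans′ p q) = trans (path-invariant g gw gb ge p) (path-invariant g gw gb ge q)

  separateFaces⇒connectedMinus : Transitive σw σb → ¬ SameCycle φ e (σw ⟨$⟩ʳ e) → ConnectedMinus σw σb e
  separateFaces⇒connectedMinus transitive e≁σwe c x d y = trans′ (toWhiteEnd c x) (sym′ (toWhiteEnd d y))
    where
    P = Path σw σb e

    σbφᵏe≢e : ∀ k → σb ⟨$⟩ʳ iter (φ ⟨$⟩ʳ_) k e ≢ e
    σbφᵏe≢e k σbφᵏe≡e = e≁σwe (suc k , cong (σw ⟨$⟩ʳ_) σbφᵏe≡e)

    acrossBlack : ∀ {z} → σb ⟨$⟩ʳ z ≢ e → P black z white (φ ⟨$⟩ʳ z)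
    acrossBlack σbz≢e = trans′ aroundB (trans′ (sym′ (edge σbz≢e)) aroundW)

    walk : ∀ k → P black e white e ⊎ P black e white (iter (φ ⟨$⟩ʳ_) (suc k) e)
    walk zero = inj₂ (acrossBlack (σbφᵏe≢e 0))
    walk (suc k) with walk k
    ... | inj₁ p = inj₁ p
    ... | inj₂ p with iter (φ ⟨$⟩ʳ_) (suc k) e Fin.≟ e
    ...   | yes φᵏ⁺¹e≡e = inj₁ (subst (P black e white) φᵏ⁺¹e≡e p)
    ...   | no  φᵏ⁺¹e≢e = inj₂ (trans′ p (trans′ (edge φᵏ⁺¹e≢e) (acrossBlack (σbφᵏe≢e (suc k)))))

    blackEnd-whiteEnd : P black e white e
    blackEnd-whiteEnd with period φ e
    ... | suc m , _ , _ , φᵐ⁺¹e≡e with walk m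
    ...   | inj₁ p = p
    ...   | inj₂ p = subst (P black e white) φᵐ⁺¹e≡e p

    whiteEnd-blackEnd : ∀ x → P white x black x
    whiteEnd-blackEnd x with x Fin.≟ e
    ... | yes refl = sym′ blackEnd-whiteEnd
    ... | no  x≢e  = edge x≢e

    reach⇒path : ∀ {x y} → Reach σw σb x y → P white x white y
    reach⇒path here      = refl′
    reach⇒path (stepW r) = trans′ aroundW (reach⇒path r)
    reach⇒path (stepB r) =
      trans′ (whiteEnd-blackEnd _) (trans′ aroundB (trans′ (sym′ (whiteEnd-blackEnd _)) (reach⇒path r)))

    toWhiteEnd : ∀ c x → P c x white e
    toWhiteEnd white x = reach⇒path (transitive x e)
    toWhiteEnd black x = trans′ (sym′ (whiteEnd-blackEnd x)) (reach⇒path (transitive x e))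

  blackEnd-isolated : σb ⟨$⟩ʳ e ≡ e → ¬ Path σw σb e white e black e
  blackEnd-isolated σbe≡e p = contradiction false≡true λ ()
    where
    atBlackEnd : Colour → Fin n → Bool
    atBlackEnd white _ = false
    atBlackEnd black x = does (x Fin.≟ e)

    atBlackEnd-σb : ∀ x → atBlackEnd black x ≡ atBlackEnd black (σb ⟨$⟩ʳ x)
    atBlackEnd-σb x with x Fin.≟ e
    ... | yes refl = sym (dec-true (σb ⟨$⟩ʳ e Fin.≟ e) σbe≡e)
    ... | no  x≢e  = sym (dec-false (σb ⟨$⟩ʳ x Fin.≟ e) (x≢e ∘ ⟨$⟩ʳ-injective σb ∘ flip trans (sym σbe≡e)))

    atBlackEnd-edge : ∀ f → f ≢ e → atBlackEnd white f ≡ atBlackEnd black f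
    atBlackEnd-edge f f≢e = sym (dec-false (f Fin.≟ e) f≢e)

    false≡true : false ≡ true
    false≡true = trans (path-invariant atBlackEnd (λ _ → refl) atBlackEnd-σb atBlackEnd-edge p)
                       (dec-true (e Fin.≟ e) refl)

  private
    u : Fin n
    u = σb ⟨$⟩ˡ e

    σbu≡e : σb ⟨$⟩ʳ u ≡ e
    σbu≡e = inverseʳ σb

    e≢u : σb ⟨$⟩ʳ e ≢ e → e ≢ u
    e≢u σbe≢e e≡u = σbe≢e (trans (cong (σb ⟨$⟩ʳ_) e≡u) σbu≡e)

  detach-transitive : σb ⟨$⟩ʳ e ≢ e → ConnectedMinus σw σb e → Transitive σw (detach σb e)
  detach-transitive σbe≢e connected x y = path⇒reach (connected white x white y)
    where
    -- The black vertex of e, deprived of e, is represented by σ• e.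
    rep : Colour → Fin n → Fin n
    rep white x = x
    rep black x = if does (x Fin.≟ e) then σb ⟨$⟩ʳ e else x

    path⇒reach : ∀ {c x d y} → Path σw σb e c x d y → Reach σw (detach σb e) (rep c x) (rep d y)
    path⇒reach refl′      = here
    path⇒reach aroundW    = stepW here
    path⇒reach {x = x} aroundB with x Fin.≟ e | σb ⟨$⟩ʳ x Fin.≟ e
    ... | yes refl | yes σbe≡e = ⊥-elim (σbe≢e σbe≡e)
    ... | yes refl | no  _     = here
    ... | no  x≢e  | yes σbx≡e =
      stepB (subst (λ z → Reach σw (detach σb e) (σb ⟨$⟩ʳ z) (σb ⟨$⟩ʳ e)) (sym τx≡e) here)
      where
      τx≡e : PC.transpose e u x ≡ e
      τx≡e = trans (cong (PC.transpose e u) (⟨$⟩ʳ-injective σb (trans σbx≡e (sym σbu≡e)))) (transpose-b e u)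
    ... | no  x≢e  | no  σbx≢e =
      stepB (subst (λ z → Reach σw (detach σb e) (σb ⟨$⟩ʳ z) (σb ⟨$⟩ʳ x)) (sym τx≡x) here)
      where
      τx≡x : PC.transpose e u x ≡ x
      τx≡x = transpose-other e u x≢e (λ x≡u → σbx≢e (trans (cong (σb ⟨$⟩ʳ_) x≡u) σbu≡e))
    path⇒reach (edge {f} f≢e) rewrite dec-false (f Fin.≟ e) f≢e = here
    path⇒reach (sym′ p)     = reach-sym (path⇒reach p)
    path⇒reach (trans′ p q) = reach-trans (path⇒reach p) (path⇒reach q)

  cycles-detach : σb ⟨$⟩ʳ e ≢ e → #cycles (detach σb e) ≡ suc (#cycles σb)
  cycles-detach σbe≢e =
    Transposed.cycles-cut σb (detach σb e) e u (e≢u σbe≢e) (λ _ → refl) (sameCycle-sym σb (1 , σbu≡e))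

  cycles-detach-faces : σb ⟨$⟩ʳ e ≢ e → SameCycle φ e (σw ⟨$⟩ʳ e) →
                        #cycles (detach σb e ∘ₚ σw) ≡ suc (#cycles φ)
  cycles-detach-faces σbe≢e e∼σwe = Transposed.cycles-cut φ (detach σb e ∘ₚ σw) e u (e≢u σbe≢e) (λ _ → refl)
    (sameCycle-trans φ e∼σwe (sameCycle-sym φ (1 , cong (σw ⟨$⟩ʳ_) σbu≡e)))

  sameFace⇒¬connectedMinus : IsSphere σw σb → SameCycle φ e (σw ⟨$⟩ʳ e) → ¬ ConnectedMinus σw σb e
  sameFace⇒¬connectedMinus sphere e∼σwe connected with σb ⟨$⟩ʳ e Fin.≟ e
  ... | yes σbe≡e = blackEnd-isolated σbe≡e (connected white e black e)
  ... | no  σbe≢e = ℕ.<⇒≱ too-many-cycles (euler-≤ σw (detach σb e) (detach-transitive σbe≢e connected))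
    where
    W = #cycles σw
    K = #cycles σb
    F = #cycles φ

    too-many-cycles : n + 2 < W + #cycles (detach σb e) + #cycles (detach σb e ∘ₚ σw)
    too-many-cycles = begin-strict
      n + 2                   <⟨ ℕ.≤-refl ⟩
      suc (n + 2)             <⟨ ℕ.≤-refl ⟩
      suc (suc (n + 2))       ≡⟨ cong (suc ∘ suc) (sym sphere) ⟩
      suc (suc (W + K + F))   ≡⟨ cong (λ z → suc (z + F)) (sym (ℕ.+-suc W K)) ⟩
      suc (W + suc K + F)     ≡⟨ sym (ℕ.+-suc (W + suc K) F) ⟩
      W + suc K + suc F       ≡⟨ sym (cong₂ (λ s t → W + s + t) cycles-K cycles-F) ⟩
      W + #cycles (detach σb e) + #cycles (detach σb e ∘ₚ σw) ∎
      where
      open ℕ.≤-Reasoning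
      cycles-K = cycles-detach σbe≢e
      cycles-F = cycles-detach-faces σbe≢e e∼σwe

mainTheorem15 : (n : ℕ) (σw σb : Permutation′ n) → Transitive σw σb → (e : Fin n)
    → ((¬ ConnectedMinus σw σb e)
         → SameOrbit (λ x → σw ⟨$⟩ʳ (σb ⟨$⟩ʳ x)) e (σw ⟨$⟩ʳ e))
    × (IsSphere σw σb
         → SameOrbit (λ x → σw ⟨$⟩ʳ (σb ⟨$⟩ʳ x)) e (σw ⟨$⟩ʳ e)
         → ¬ ConnectedMinus σw σb e)
mainTheorem15 n σw σb transitive e =
  (λ disconnected → decidable-stable (sameCycle? (σb ∘ₚ σw) e (σw ⟨$⟩ʳ e))
                                     (disconnected ∘ separateFaces⇒connectedMinus transitive)) ,
  sameFace⇒¬connectedMinus
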